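{- Let $\mathfrak K=(K,\bigsqcup,\odot,{}^*,{\sim},e)$ be an involutive generalized dynamic algebra. Then the map ${\sim}{\sim}:K\to\widetilde K$, $x\mapsto{\sim}{\sim}x$, is a surjective homomorphism of left $K$-modules (from $K$, regarded as a left module over itself via $\odot$, to $(\widetilde K,\bigvee,\bullet)$), i.e. it is surjective and satisfies ${\sim}{\sim}(\bigsqcup S)=\bigvee_{s\in S}{\sim}{\sim}s$ and ${\sim}{\sim}(u\odot v)=u\bullet{\sim}{\sim}v$ for all $S\subseteq K$, $u,v\in K$; and the relation $\equiv$ is a quantale congruence on $K$ (an equivalence relation preserved by $\odot$ and by arbitrary joins).
   Context: A unital involutive quantale is $(K,\bigsqcup,\odot,{}^*,e)$ where $(K,\bigsqcup)$ is a complete join-semilattice (binary join $\sqcup$), $\odot$ is associative and distributes over arbitrary joins in each argument, $e$ is a two-sided unit, and ${}^*$ satisfies $x^{**}=x$, $(x\odot y)^*=y^*\odot x^*$, $(\bigsqcup_i x_i)^*=\bigsqcup_i x_i^*$. An involutive generalized dynamic algebra is $(K,\bigsqcup,\odot,{}^*,{\sim},e)$ where $(K,\bigsqcup,\odot,{}^*,e)$ is a unital involutive quantale and ${\sim}:K\to K$ satisfies, for all $x,y\in K$ and all (possibly empty) families $(x_i)$: (i) ${\sim}(x\odot{\sim}{\sim}y)={\sim}(x\odot y)$; (ii) ${\sim}(\bigsqcup_i{\sim}{\sim}x_i)={\sim}(\bigsqcup_i x_i)$; (iii) $({\sim}x)^*={\sim}x$; (iv) ${\sim}{\sim}({\sim}{\sim}x\odot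 y)={\sim}({\sim}x\sqcup{\sim}({\sim}x\sqcup y))$. Notation: $\widetilde K=\{{\sim}k:k\in K\}$; for $W\subseteq\widetilde K$, $\bigvee W:={\sim}{\sim}(\bigsqcup W)$; $k\bullet v:={\sim}{\sim}(k\odot v)$ for $k\in K$, $v\in\widetilde K$ (this makes $(\widetilde K,\bigvee,\bullet)$ a left $K$-module); $k\equiv l$ iff $k\bullet w=l\bullet w$ for all $w\in\widetilde K$. A homomorphism of left $K$-modules preserves arbitrary joins and the action. -}

module Defs where

open import Level using (Level; suc)
open import Data.Bool using (Bool; true; false)
open import Data.Product using (Σ; ∃; _×_; _,_; proj₁)
open import Relation.Binary.PropositionalEquality using (_≡_)
open import Relation.Binary.Structures using (IsPartialOrder)

join2 : {ℓ : Level} {K : Set ℓ} → ({I : Set ℓ} → (I → K) → K) → K → K → K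
join2 {ℓ} {K} ⨆ x y = ⨆ {I = Level.Lift ℓ Bool} pick
  where
    pick : Level.Lift ℓ Bool → K
    pick (Level.lift true)  = x
    pick (Level.lift false) = y

-- The complete join-semilattice (K, ⨆) is given by a partial order _≤_ (w.r.t. _≡_)
-- together with a least-upper-bound operator ⨆ on arbitrary (possibly empty)
-- families indexed by types I : Set ℓ (the carrier also lives in Set ℓ, so that
-- subsets S : K → Set ℓ are such families via Σ K S).
record IGDA (ℓ : Level) : Set (suc ℓ) where
  infixl 7 _⊙_
  field
    K        : Set ℓ
    _≤_      : K → K → Set ℓ
    isPO     : IsPartialOrder _≡_ _≤_
    ⨆        : {I : Set ℓ} → (I → K) → K
    ⨆-upper  : {I : Set ℓ} (f : I → K) (i : I) → f i ≤ ⨆ f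
    ⨆-least  : {I : Set ℓ} (f : I → K) (u : K) → ((i : I) → f i ≤ u) → ⨆ f ≤ u
    _⊙_      : K → K → K
    e        : K
    _*       : K → K
    ~        : K → K
    ⊙-assoc  : ∀ x y z → (x ⊙ y) ⊙ z ≡ x ⊙ (y ⊙ z)
    ⊙-distˡ  : ∀ x {I : Set ℓ} (f : I → K) → x ⊙ ⨆ f ≡ ⨆ (λ i → x ⊙ f i)
    ⊙-distʳ  : ∀ {I : Set ℓ} (f : I → K) x → ⨆ f ⊙ x ≡ ⨆ (λ i → f i ⊙ x)
    e-unitˡ  : ∀ x → e ⊙ x ≡ x
    e-unitʳ  : ∀ x → x ⊙ e ≡ x
    *-invol  : ∀ x → (x *) * ≡ x
    *-anti   : ∀ x y → (x ⊙ y) * ≡ (y *) ⊙ (x *)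
    *-⨆      : ∀ {I : Set ℓ} (f : I → K) → (⨆ f) * ≡ ⨆ (λ i → (f i) *)

  field
    ~-i   : ∀ x y → ~ (x ⊙ ~ (~ y)) ≡ ~ (x ⊙ y)
    ~-ii  : ∀ {I : Set ℓ} (x : I → K) → ~ (⨆ (λ i → ~ (~ (x i)))) ≡ ~ (⨆ x)
    ~-iii : ∀ x → (~ x) * ≡ ~ x
    ~-iv  : ∀ x y → ~ (~ (~ (~ x) ⊙ y)) ≡ ~ (join2 ⨆ (~ x) (~ (join2 ⨆ (~ x) y)))

  _⊔_ : K → K → K
  x ⊔ y = join2 ⨆ x y

  K̃ : K → Set ℓ
  K̃ w = ∃ λ k → w ≡ ~ k

  ~~ : K → K
  ~~ x = ~ (~ x)

  ⨆ₛ : (K → Set ℓ) → K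
  ⨆ₛ S = ⨆ {I = Σ K S} proj₁

  ⋁ : (K → Set ℓ) → K
  ⋁ W = ~~ (⨆ₛ W)

  _•_ : K → K → K
  k • v = ~~ (k ⊙ v)

  ~~[_] : (K → Set ℓ) → (K → Set ℓ)
  ~~[ S ] w = ∃ λ s → S s × (w ≡ ~~ s)

  _≋_ : K → K → Set ℓ
  k ≋ l = ∀ w → K̃ w → k • w ≡ l • w

-- Axioms (i) and (ii) say that ~ cannot see a double negation under ⊙ on the
-- right or inside a join; negating them once more yields the two homomorphism
-- laws, and (i) with x = e gives ~~~ = ~, so ~~ fixes K̃ and is onto it.  The
-- action is associative and join-distributive up to ~~, which makes ≋
-- compatible with ⊙ and ⨆.
module Submission where

open import Defs
open import Level using (Level)
open import Data.Product using (Σ; ∃; _×_; _,_; proj₁)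
open import Relation.Binary.PropositionalEquality
  using (_≡_; refl; sym; trans; cong; subst; module ≡-Reasoning)
open import Relation.Binary.Structures using (IsEquivalence; IsPartialOrder)

module _ {ℓ : Level} (𝔎 : IGDA ℓ) where
  open IGDA 𝔎
  open IsPartialOrder isPO using (antisym)
  open ≡-Reasoning

  ~-~~ : ∀ x → ~ (~~ x) ≡ ~ x
  ~-~~ x = begin
    ~ (~~ x)      ≡⟨ cong ~ (sym (e-unitˡ (~~ x))) ⟩
    ~ (e ⊙ ~~ x)  ≡⟨ ~-i e x ⟩
    ~ (e ⊙ x)     ≡⟨ cong ~ (e-unitˡ x) ⟩
    ~ x           ∎

  ~~∈K̃ : ∀ x → K̃ (~~ x)
  ~~∈K̃ x = ~ x , refl

  ~~-fixes-K̃ : ∀ {w} → K̃ w → ~~ w ≡ w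
  ~~-fixes-K̃ (k , refl) = ~-~~ k

  ~~-⊙ʳ : ∀ u v → ~~ (u ⊙ ~~ v) ≡ ~~ (u ⊙ v)
  ~~-⊙ʳ u v = cong ~ (~-i u v)

  ~~-⨆ : {I : Set ℓ} (f : I → K) → ~~ (⨆ (λ i → ~~ (f i))) ≡ ~~ (⨆ f)
  ~~-⨆ f = cong ~ (~-ii f)

  ⨆-cong : {I : Set ℓ} {f g : I → K} → (∀ i → f i ≡ g i) → ⨆ f ≡ ⨆ g
  ⨆-cong {f = f} {g} f≡g = antisym
    (⨆-least f (⨆ g) (λ i → subst (_≤ ⨆ g) (sym (f≡g i)) (⨆-upper g i)))
    (⨆-least g (⨆ f) (λ i → subst (_≤ ⨆ f) (f≡g i) (⨆-upper f i)))

  ⨆ₛ-image : (g : K → K) (S : K → Set ℓ) →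
             ⨆ₛ (λ w → ∃ λ s → S s × (w ≡ g s)) ≡ ⨆ {I = Σ K S} (λ i → g (proj₁ i))
  ⨆ₛ-image g S = antisym
    (⨆-least proj₁ (⨆ g∘proj₁)
      (λ { (_ , s , s∈S , refl) → ⨆-upper g∘proj₁ (s , s∈S) }))
    (⨆-least g∘proj₁ (⨆ₛ image)
      (λ { (s , s∈S) → ⨆-upper {I = Σ K image} proj₁ (g s , s , s∈S , refl) }))
    where
      image : K → Set ℓ
      image w = ∃ λ s → S s × (w ≡ g s)
      g∘proj₁ : Σ K S → K
      g∘proj₁ i = g (proj₁ i)

  ~~-⨆ₛ : (S : K → Set ℓ) → ~~ (⨆ₛ S) ≡ ⋁ ~~[ S ]
  ~~-⨆ₛ S = begin
    ~~ (⨆ₛ S)                           ≡⟨ sym (~~-⨆ proj₁) ⟩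
    ~~ (⨆ (λ i → ~~ (proj₁ {B = S} i)))  ≡⟨ cong ~~ (sym (⨆ₛ-image ~~ S)) ⟩
    ⋁ ~~[ S ]                           ∎

  •-assoc : ∀ x y w → (x ⊙ y) • w ≡ x • (y • w)
  •-assoc x y w = begin
    ~~ ((x ⊙ y) ⊙ w)   ≡⟨ cong ~~ (⊙-assoc x y w) ⟩
    ~~ (x ⊙ (y ⊙ w))   ≡⟨ sym (~~-⊙ʳ x (y ⊙ w)) ⟩
    ~~ (x ⊙ (y • w))   ∎

  ⨆-• : {I : Set ℓ} (f : I → K) (w : K) → ⨆ f • w ≡ ~~ (⨆ (λ i → f i • w))
  ⨆-• f w = begin
    ~~ (⨆ f ⊙ w)               ≡⟨ cong ~~ (⊙-distʳ f w) ⟩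
    ~~ (⨆ (λ i → f i ⊙ w))     ≡⟨ sym (~~-⨆ (λ i → f i ⊙ w)) ⟩
    ~~ (⨆ (λ i → f i • w))     ∎

  ≋-isEquivalence : IsEquivalence _≋_
  ≋-isEquivalence = record
    { refl  = λ _ _ → refl
    ; sym   = λ k≋l w w∈K̃ → sym (k≋l w w∈K̃)
    ; trans = λ k≋l l≋m w w∈K̃ → trans (k≋l w w∈K̃) (l≋m w w∈K̃)
    }

  ⊙-resp-≋ : ∀ x x′ y y′ → x ≋ x′ → y ≋ y′ → (x ⊙ y) ≋ (x′ ⊙ y′)
  ⊙-resp-≋ x x′ y y′ x≋x′ y≋y′ w w∈K̃ = begin
    (x ⊙ y) • w      ≡⟨ •-assoc x y w ⟩
    x • (y • w)      ≡⟨ cong (x •_) (y≋y′ w w∈K̃) ⟩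
    x • (y′ • w)     ≡⟨ x≋x′ (y′ • w) (~ (y′ ⊙ w) , refl) ⟩
    x′ • (y′ • w)    ≡⟨ sym (•-assoc x′ y′ w) ⟩
    (x′ ⊙ y′) • w    ∎

  ⨆-resp-≋ : {I : Set ℓ} (f g : I → K) → (∀ i → f i ≋ g i) → ⨆ f ≋ ⨆ g
  ⨆-resp-≋ f g f≋g w w∈K̃ = begin
    ⨆ f • w                   ≡⟨ ⨆-• f w ⟩
    ~~ (⨆ (λ i → f i • w))    ≡⟨ cong ~~ (⨆-cong (λ i → f≋g i w w∈K̃)) ⟩
    ~~ (⨆ (λ i → g i • w))    ≡⟨ sym (⨆-• g w) ⟩
    ⨆ g • w                   ∎

proposition3p4 : {ℓ : Level} (𝔎 : IGDA ℓ) → let open IGDA 𝔎 in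
    ((x : K) → K̃ (~~ x))
    × ((w : K) → K̃ w → ∃ λ x → ~~ x ≡ w)
    × ((S : K → Set ℓ) → ~~ (⨆ₛ S) ≡ ⋁ ~~[ S ])
    × ((u v : K) → ~~ (u ⊙ v) ≡ u • ~~ v)
    × IsEquivalence _≋_
    × (∀ x x′ y y′ → x ≋ x′ → y ≋ y′ → (x ⊙ y) ≋ (x′ ⊙ y′))
    × (∀ {I : Set ℓ} (f g : I → K) → (∀ i → f i ≋ g i) → ⨆ f ≋ ⨆ g)
proposition3p4 𝔎 =
    ~~∈K̃ 𝔎
  , (λ w w∈K̃ → w , ~~-fixes-K̃ 𝔎 w∈K̃)
  , ~~-⨆ₛ 𝔎
  , (λ u v → sym (~~-⊙ʳ 𝔎 u v))
  , ≋-isEquivalence 𝔎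
  , ⊙-resp-≋ 𝔎
  , ⨆-resp-≋ 𝔎
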